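{- Let $\mathbb{F}$ be a field of characteristic zero. There is at most one circular integral functional on $\mathbb{F}[\alpha_1,\alpha_2]$ with respect to $S^1$; that is, if $\phi$ and $\phi'$ are both circular integral functionals with respect to $S^1$, then $\phi=\phi'$.
   Context: $S^1=\{[x,y]\in\mathbb{F}^2: x^2+y^2=1_{\mathbb{F}}\}$. $SO(2,\mathbb{F})$ is the group of $2\times2$ matrices $h$ over $\mathbb{F}$ with $h^{ -1}=h^T$ and $\det h=1$, acting on $\mathbb{F}[\alpha_1,\alpha_2]$ by $h\cdot\pi(\alpha_1,\alpha_2)=\pi(h_{11}\alpha_1+h_{21}\alpha_2,\,h_{12}\alpha_1+h_{22}\alpha_2)$. A circular integral functional with respect to $S^1$ is an $\mathbb{F}$-linear map $\phi:\mathbb{F}[\alpha_1,\alpha_2]\to\mathbb{F}$ such that (Normalization) $\phi(\mathbf{1})=1_{\mathbb{F}}$ for the constant polynomial $\mathbf{1}$; (Locality) $\phi(\pi)=0$ whenever $\pi(x,y)=0$ for all $[x,y]\in S^1$; (Invariance) $\phi(h\cdot\pi)=\phi(\pi)$ for all $\pi$ and all $h\in SO(2,\mathbb{F})$. -}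

module Defs where

open import Level using (Level; _⊔_; suc)
open import Data.Nat using (ℕ; zero; suc)
open import Data.Product using (_×_; _,_; Σ)
open import Data.List using (List; []; _∷_; _++_; concatMap; map)
open import Data.Fin using (Fin)
open Data.Fin using () renaming (zero to fzero; suc to fsuc)
import Data.Nat
open import Relation.Nullary using (¬_)
open import Relation.Binary.PropositionalEquality using (_≡_)
open import Algebra.Bundles using (CommutativeRing)

record Field (c ℓ : Level) : Set (Level.suc (c ⊔ ℓ)) where
  field
    cring : CommutativeRing c ℓ
  open CommutativeRing cring public
  field
    0≉1     : ¬ (0# ≈ 1#)
    inverse : ∀ x → ¬ (x ≈ 0#) → Σ Carrier λ y → x * y ≈ 1#

module _ {c ℓ : Level} (F : Field c ℓ) where
  open Field F

  natₑ : ℕ → Carrier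
  natₑ zero    = 0#
  natₑ (suc n) = 1# + natₑ n

  CharZero : Set ℓ
  CharZero = ∀ n → natₑ n ≈ 0# → n ≡ 0

  -- Polynomials in F[α₁, α₂], represented as finite formal sums of
  -- monomials  c · α₁^i · α₂^j  (a term (c , i , j)).  Two representations
  -- denote the same polynomial iff all their coefficients agree.

  Term : Set c
  Term = Carrier × ℕ × ℕ

  Poly : Set c
  Poly = List Term

  _^ₑ_ : Carrier → ℕ → Carrier
  x ^ₑ zero  = 1#
  x ^ₑ suc n = x * (x ^ₑ n)

  coeff : Poly → ℕ → ℕ → Carrier
  coeff []                 i j = 0#
  coeff ((a , k , l) ∷ p)  i j with k Data.Nat.≟ i | l Data.Nat.≟ j
  ... | Relation.Nullary.yes _ | Relation.Nullary.yes _ = a + coeff p i j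
  ... | _ | _ = coeff p i j

  _≈ₚ_ : Poly → Poly → Set ℓ
  p ≈ₚ q = ∀ i j → coeff p i j ≈ coeff q i j

  eval : Poly → Carrier → Carrier → Carrier
  eval []                x y = 0#
  eval ((a , i , j) ∷ p) x y = a * ((x ^ₑ i) * (y ^ₑ j)) + eval p x y

  constP : Carrier → Poly
  constP a = (a , 0 , 0) ∷ []

  oneP : Poly
  oneP = constP 1#

  scaleP : Carrier → Poly → Poly
  scaleP a = map (λ { (b , i , j) → (a * b , i , j) })

  mulP : Poly → Poly → Poly
  mulP p q = concatMap (λ { (a , i , j) →
               map (λ { (b , k , l) → (a * b , i Data.Nat.+ k , j Data.Nat.+ l) }) q }) p

  powP : Poly → ℕ → Poly
  powP p zero    = oneP
  powP p (suc n) = mulP p (powP p n)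

  linP : Carrier → Carrier → Poly
  linP a b = (a , 1 , 0) ∷ (b , 0 , 1) ∷ []

  Mat2 : Set c
  Mat2 = Fin 2 → Fin 2 → Carrier

  0F 1F : Fin 2
  0F = fzero
  1F = fsuc fzero

  _·ₘ_ : Mat2 → Mat2 → Mat2
  (A ·ₘ B) i j = A i 0F * B 0F j + A i 1F * B 1F j

  transpose : Mat2 → Mat2
  transpose A i j = A j i

  idM : Mat2
  idM fzero    fzero    = 1#
  idM fzero    (fsuc _) = 0#
  idM (fsuc _) fzero    = 0#
  idM (fsuc _) (fsuc _) = 1#

  _≈ₘ_ : Mat2 → Mat2 → Set ℓ
  A ≈ₘ B = ∀ i j → A i j ≈ B i j

  det : Mat2 → Carrier
  det A = A 0F 0F * A 1F 1F - A 0F 1F * A 1F 0F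

  InSO2 : Mat2 → Set ℓ
  InSO2 h = (h ·ₘ transpose h) ≈ₘ idM × (transpose h ·ₘ h) ≈ₘ idM × det h ≈ 1#

  -- (h · π)(α₁, α₂) = π(h₁₁α₁ + h₂₁α₂ , h₁₂α₁ + h₂₂α₂)
  act : Mat2 → Poly → Poly
  act h []                = []
  act h ((a , i , j) ∷ p) =
    scaleP a (mulP (powP (linP (h 0F 0F) (h 1F 0F)) i)
                   (powP (linP (h 0F 1F) (h 1F 1F)) j)) ++ act h p

  OnS1 : Carrier → Carrier → Set ℓ
  OnS1 x y = x * x + y * y ≈ 1#

  record IsLinearFunctional (φ : Poly → Carrier) : Set (c ⊔ ℓ) where
    field
      wellDefined : ∀ p q → p ≈ₚ q → φ p ≈ φ q
      additive    : ∀ p q → φ (p ++ q) ≈ φ p + φ q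
      homogeneous : ∀ a p → φ (scaleP a p) ≈ a * φ p

  record IsCircularIntegralFunctional (φ : Poly → Carrier) : Set (c ⊔ ℓ) where
    field
      linear        : IsLinearFunctional φ
      normalization : φ oneP ≈ 1#
      locality      : ∀ π → (∀ x y → OnS1 x y → eval π x y ≈ 0#) → φ π ≈ 0#
      invariance    : ∀ π h → InSO2 h → φ (act h π) ≈ φ π

{-# OPTIONS --safe #-}
module Submission where

-- Let ψ = φ − φ′: it is linear, kills 1 and every polynomial vanishing on S¹, and is invariant
-- under the rotation by z = (3 + 4i)/5. Writing Pₙ for the pair (Re, Im) of (α₁ + iα₂)ⁿ, this
-- rotation multiplies Pₙ by zⁿ, so ψ(Pₙ) is a fixed point of multiplication by zⁿ. As
-- (3 + 4i)ⁿ ≡ 3 + 4i (mod 5), Re zⁿ ≠ 1 for n ≥ 1 in characteristic zero, and a number of norm 1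
-- with real part ≠ 1 fixes only 0 (as 2 ≠ 0); hence ψ(Pₙ) = 0. Finally, for w = x + iy on S¹,
-- x·wⁿ = (wⁿ⁺¹ + w̄wⁿ)/2 and y·wⁿ = (wⁿ⁺¹ − w̄wⁿ)/2i with w̄wⁿ⁺¹ = wⁿ, so every monomial, hence
-- every polynomial, agrees on S¹ with a polynomial killed by ψ.

open import Defs
open import Level using (Level; _⊔_)
open import Function using (_∘_)
open import Data.Nat as ℕ using (ℕ; zero; suc)
import Data.Nat.Properties as ℕ
import Data.Nat.Divisibility as ℕ∣
open import Data.Integer as ℤ using (ℤ; +_; -[1+_]; 0ℤ)
import Data.Integer.Properties as ℤ
open import Data.Integer.Divisibility.Signed using (divides; ∣⇒∣ᵤ)
import Data.Integer.Tactic.RingSolver as ℤ-Solver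
open import Data.Sign as Sign using (Sign)
open import Data.Fin using () renaming (zero to fzero; suc to fsuc)
open import Data.Maybe using (Maybe; just; nothing)
open import Data.Product using (Σ; _×_; _,_; proj₁; proj₂; ∃₂)
open import Data.List using (_∷_; []; _++_; map)
open import Relation.Nullary using (¬_; yes; no)
open import Relation.Binary.PropositionalEquality as ≡ using (_≡_; _≢_)
open import Algebra.Bundles using (CommutativeRing)
open import Algebra.Solver.Ring.AlmostCommutativeRing
  using (_-Raw-AlmostCommutative⟶_; fromCommutativeRing)
import Algebra.Solver.Ring

module IntegerEmbedding {c ℓ : Level} (R : CommutativeRing c ℓ) where
  open CommutativeRing R
  open import Algebra.Properties.Ring ring
  open import Algebra.Properties.Semiring.Mult.TCOptimised semiring using (1+×; ×-homo-+; ×1-homo-*)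
    renaming (_×_ to _×ₙ_)
  open import Algebra.Properties.CommutativeSemigroup *-commutativeSemigroup using (interchange)
  open import Relation.Binary.Reasoning.Setoid setoid

  -- With the type-checking optimised _×ₙ_, fromℤ (+ 0) and fromℤ (+ 1) are literally 0# and 1#,
  -- so the solver constants con (+ 0) and con (+ 1) need no rewriting.
  fromℤ : ℤ → Carrier
  fromℤ (+ n)      = n ×ₙ 1#
  fromℤ -[1+ n ]   = - (suc n ×ₙ 1#)

  fromSign : Sign → Carrier
  fromSign Sign.+ = 1#
  fromSign Sign.- = - 1#

  fromSign-* : ∀ s t → fromSign (s Sign.* t) ≈ fromSign s * fromSign t
  fromSign-* Sign.+ t      = sym (*-identityˡ _)
  fromSign-* Sign.- Sign.+ = sym (*-identityʳ _)
  fromSign-* Sign.- Sign.- = sym (trans (-1*x≈-x (- 1#)) (-‿involutive 1#))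

  fromℤ-◃ : ∀ s n → fromℤ (s ℤ.◃ n) ≈ fromSign s * (n ×ₙ 1#)
  fromℤ-◃ s      zero    = sym (zeroʳ _)
  fromℤ-◃ Sign.+ (suc n) = sym (*-identityˡ _)
  fromℤ-◃ Sign.- (suc n) = sym (-1*x≈-x _)

  fromℤ-signAbs : ∀ i → fromℤ i ≈ fromSign (ℤ.sign i) * (ℤ.∣ i ∣ ×ₙ 1#)
  fromℤ-signAbs (+ n)    = sym (*-identityˡ _)
  fromℤ-signAbs -[1+ n ] = sym (-1*x≈-x _)

  fromℤ-⊖ : ∀ m n → fromℤ (m ℤ.⊖ n) ≈ m ×ₙ 1# - n ×ₙ 1#
  fromℤ-⊖ m       zero    = sym (trans (+-congˡ -0#≈0#) (+-identityʳ _))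
  fromℤ-⊖ zero    (suc n) = sym (+-identityˡ _)
  fromℤ-⊖ (suc m) (suc n) = begin
    fromℤ (suc m ℤ.⊖ suc n)           ≡⟨ ≡.cong fromℤ (ℤ.[1+m]⊖[1+n]≡m⊖n m n) ⟩
    fromℤ (m ℤ.⊖ n)                   ≈⟨ fromℤ-⊖ m n ⟩
    M - N                             ≈⟨ sym (xyx⁻¹≈y 1# (M - N)) ⟩
    1# + (M - N) - 1#                 ≈⟨ +-congʳ (sym (+-assoc 1# M (- N))) ⟩
    1# + M - N - 1#                   ≈⟨ +-assoc (1# + M) (- N) (- 1#) ⟩
    1# + M + (- N - 1#)               ≈⟨ +-congˡ (trans (+-comm (- N) (- 1#)) (-‿+-comm 1# N)) ⟩
    1# + M - (1# + N)                 ≈⟨ +-cong (1+× m 1#) (-‿cong (1+× n 1#)) ⟨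
    suc m ×ₙ 1# - suc n ×ₙ 1#         ∎
    where
    M N : Carrier
    M = m ×ₙ 1#
    N = n ×ₙ 1#

  fromℤ-+ : ∀ i j → fromℤ (i ℤ.+ j) ≈ fromℤ i + fromℤ j
  fromℤ-+ (+ m)    (+ n)    = ×-homo-+ 1# m n
  fromℤ-+ (+ m)    -[1+ n ] = fromℤ-⊖ m (suc n)
  fromℤ-+ -[1+ m ] (+ n)    = trans (fromℤ-⊖ n (suc m)) (+-comm _ _)
  fromℤ-+ -[1+ m ] -[1+ n ] = begin
    - (suc (suc (m ℕ.+ n)) ×ₙ 1#)      ≡⟨ ≡.cong (λ k → - (suc k ×ₙ 1#)) (ℕ.+-suc m n) ⟨
    - ((suc m ℕ.+ suc n) ×ₙ 1#)        ≈⟨ -‿cong (×-homo-+ 1# (suc m) (suc n)) ⟩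
    - (suc m ×ₙ 1# + suc n ×ₙ 1#)       ≈⟨ -‿+-comm _ _ ⟨
    - (suc m ×ₙ 1#) - (suc n ×ₙ 1#)     ∎

  fromℤ-* : ∀ i j → fromℤ (i ℤ.* j) ≈ fromℤ i * fromℤ j
  fromℤ-* i j = begin
    fromℤ (ℤ.sign i Sign.* ℤ.sign j ℤ.◃ ℤ.∣ i ∣ ℕ.* ℤ.∣ j ∣)
      ≈⟨ fromℤ-◃ (ℤ.sign i Sign.* ℤ.sign j) (ℤ.∣ i ∣ ℕ.* ℤ.∣ j ∣) ⟩
    fromSign (ℤ.sign i Sign.* ℤ.sign j) * ((ℤ.∣ i ∣ ℕ.* ℤ.∣ j ∣) ×ₙ 1#)
      ≈⟨ *-cong (fromSign-* (ℤ.sign i) (ℤ.sign j)) (×1-homo-* ℤ.∣ i ∣ ℤ.∣ j ∣) ⟩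
    (fromSign (ℤ.sign i) * fromSign (ℤ.sign j)) * ((ℤ.∣ i ∣ ×ₙ 1#) * (ℤ.∣ j ∣ ×ₙ 1#))
      ≈⟨ interchange _ _ _ _ ⟩
    (fromSign (ℤ.sign i) * (ℤ.∣ i ∣ ×ₙ 1#)) * (fromSign (ℤ.sign j) * (ℤ.∣ j ∣ ×ₙ 1#))
      ≈⟨ *-cong (fromℤ-signAbs i) (fromℤ-signAbs j) ⟨
    fromℤ i * fromℤ j ∎

  fromℤ-neg : ∀ i → fromℤ (ℤ.- i) ≈ - fromℤ i
  fromℤ-neg (+ zero)    = sym -0#≈0#
  fromℤ-neg (+ (suc n)) = refl
  fromℤ-neg -[1+ n ]    = sym (-‿involutive _)

  fromℤ-morphism : ℤ.+-*-rawRing -Raw-AlmostCommutative⟶ fromCommutativeRing R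
  fromℤ-morphism = record
    { ⟦_⟧    = fromℤ
    ; +-homo = fromℤ-+
    ; *-homo = fromℤ-*
    ; -‿homo = fromℤ-neg
    ; 0-homo = refl
    ; 1-homo = refl
    }

  fromℤ-≟ : ∀ i j → Maybe (fromℤ i ≈ fromℤ j)
  fromℤ-≟ i j with i ℤ.≟ j
  ... | yes i≡j = just (reflexive (≡.cong fromℤ i≡j))
  ... | no  _   = nothing

  -- Integer coefficients with decidable equality let the solver cancel terms such as x - x.
  open Algebra.Solver.Ring ℤ.+-*-rawRing (fromCommutativeRing R) fromℤ-morphism fromℤ-≟ public

  fromℤ-injective : (∀ n → fromℤ (+ n) ≈ 0# → n ≡ 0) → ∀ {i j} → fromℤ i ≈ fromℤ j → i ≡ j
  fromℤ-injective char0 {i} {j} i≈j = ℤ.i-j≡0⇒i≡j i j (kernel (i ℤ.- j) (begin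
    fromℤ (i ℤ.- j)       ≈⟨ fromℤ-+ i (ℤ.- j) ⟩
    fromℤ i + fromℤ (ℤ.- j) ≈⟨ +-cong i≈j (fromℤ-neg j) ⟩
    fromℤ j - fromℤ j     ≈⟨ -‿inverseʳ (fromℤ j) ⟩
    0#                    ∎))
    where
    kernel : ∀ i → fromℤ i ≈ 0# → i ≡ 0ℤ
    kernel (+ n)    n≈0 = ≡.cong +_ (char0 n n≈0)
    kernel -[1+ n ] n≈0 with char0 (suc n) (-‿injective (trans n≈0 (sym -0#≈0#)))
    ... | ()

module Gaussian {c ℓ : Level} (R : CommutativeRing c ℓ) where
  open CommutativeRing R
  open IntegerEmbedding R
  open import Relation.Binary.Reasoning.Setoid setoid

  𝔾 : Set c
  𝔾 = Carrier × Carrier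

  re im : 𝔾 → Carrier
  re = proj₁
  im = proj₂

  infix  4 _≈ᵍ_
  infixl 6 _+ᵍ_
  infixl 7 _*ᵍ_
  infixr 8 _·ᵍ_ _^ᵍ_

  _≈ᵍ_ : 𝔾 → 𝔾 → Set ℓ
  z ≈ᵍ w = re z ≈ re w × im z ≈ im w

  _*ᵍ_ : 𝔾 → 𝔾 → 𝔾
  (a , b) *ᵍ (c , d) = a * c - b * d , b * c + a * d

  _+ᵍ_ : 𝔾 → 𝔾 → 𝔾
  (a , b) +ᵍ (c , d) = a + c , b + d

  _·ᵍ_ : Carrier → 𝔾 → 𝔾
  r ·ᵍ (a , b) = r * a , r * b

  conj : 𝔾 → 𝔾
  conj (a , b) = a , - b

  0ᵍ 1ᵍ : 𝔾
  0ᵍ = 0# , 0#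
  1ᵍ = 1# , 0#

  _^ᵍ_ : 𝔾 → ℕ → 𝔾
  z ^ᵍ zero  = 1ᵍ
  z ^ᵍ suc n = z *ᵍ z ^ᵍ n

  normᵍ : 𝔾 → Carrier
  normᵍ (a , b) = a * a + b * b

  ≈ᵍ-refl : ∀ {z} → z ≈ᵍ z
  ≈ᵍ-refl = refl , refl

  ≈ᵍ-sym : ∀ {z w} → z ≈ᵍ w → w ≈ᵍ z
  ≈ᵍ-sym (p , q) = sym p , sym q

  ≈ᵍ-trans : ∀ {z w u} → z ≈ᵍ w → w ≈ᵍ u → z ≈ᵍ u
  ≈ᵍ-trans (p , q) (p′ , q′) = trans p p′ , trans q q′

  *ᵍ-cong : ∀ {z z′ w w′} → z ≈ᵍ z′ → w ≈ᵍ w′ → z *ᵍ w ≈ᵍ z′ *ᵍ w′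
  *ᵍ-cong (a , b) (c , d) = +-cong (*-cong a c) (-‿cong (*-cong b d)) , +-cong (*-cong b c) (*-cong a d)

  *ᵍ-identityʳ : ∀ z → z *ᵍ 1ᵍ ≈ᵍ z
  *ᵍ-identityʳ (a , b) =
    solve 2 (λ a b → a :* con (+ 1) :- b :* con (+ 0) := a) refl a b ,
    solve 2 (λ a b → b :* con (+ 1) :+ a :* con (+ 0) := b) refl a b

  *ᵍ-interchange : ∀ z w z′ w′ → (z *ᵍ w) *ᵍ (z′ *ᵍ w′) ≈ᵍ (z *ᵍ z′) *ᵍ (w *ᵍ w′)
  *ᵍ-interchange (a , b) (c , d) (a′ , b′) (c′ , d′) =
    solve 8 (λ a b c d a′ b′ c′ d′ →
      (a :* c :- b :* d) :* (a′ :* c′ :- b′ :* d′) :- (b :* c :+ a :* d) :* (b′ :* c′ :+ a′ :* d′)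
      := (a :* a′ :- b :* b′) :* (c :* c′ :- d :* d′) :- (b :* a′ :+ a :* b′) :* (d :* c′ :+ c :* d′))
      refl a b c d a′ b′ c′ d′ ,
    solve 8 (λ a b c d a′ b′ c′ d′ →
      (b :* c :+ a :* d) :* (a′ :* c′ :- b′ :* d′) :+ (a :* c :- b :* d) :* (b′ :* c′ :+ a′ :* d′)
      := (b :* a′ :+ a :* b′) :* (c :* c′ :- d :* d′) :+ (a :* a′ :- b :* b′) :* (d :* c′ :+ c :* d′))
      refl a b c d a′ b′ c′ d′

  ^ᵍ-distrib-*ᵍ : ∀ z w n → (z *ᵍ w) ^ᵍ n ≈ᵍ z ^ᵍ n *ᵍ w ^ᵍ n
  ^ᵍ-distrib-*ᵍ z w zero = ≈ᵍ-sym (*ᵍ-identityʳ 1ᵍ)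
  ^ᵍ-distrib-*ᵍ z w (suc n) = ≈ᵍ-trans (*ᵍ-cong ≈ᵍ-refl (^ᵍ-distrib-*ᵍ z w n)) (*ᵍ-interchange z w (z ^ᵍ n) (w ^ᵍ n))

  ^ᵍ-cong : ∀ {z w} n → z ≈ᵍ w → z ^ᵍ n ≈ᵍ w ^ᵍ n
  ^ᵍ-cong zero    z≈w = ≈ᵍ-refl
  ^ᵍ-cong (suc n) z≈w = *ᵍ-cong z≈w (^ᵍ-cong n z≈w)

  normᵍ-*ᵍ : ∀ z w → normᵍ (z *ᵍ w) ≈ normᵍ z * normᵍ w
  normᵍ-*ᵍ (a , b) (c , d) = solve 4 (λ a b c d →
    (a :* c :- b :* d) :* (a :* c :- b :* d) :+ (b :* c :+ a :* d) :* (b :* c :+ a :* d)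
    := (a :* a :+ b :* b) :* (c :* c :+ d :* d)) refl a b c d

  normᵍ-^ᵍ : ∀ {z} n → normᵍ z ≈ 1# → normᵍ (z ^ᵍ n) ≈ 1#
  normᵍ-^ᵍ zero    _  = solve 0 (con (+ 1) :* con (+ 1) :+ con (+ 0) :* con (+ 0) := con (+ 1)) refl
  normᵍ-^ᵍ {z} (suc n) ∣z∣≈1 = begin
    normᵍ (z *ᵍ z ^ᵍ n)       ≈⟨ normᵍ-*ᵍ z (z ^ᵍ n) ⟩
    normᵍ z * normᵍ (z ^ᵍ n)  ≈⟨ *-cong ∣z∣≈1 (normᵍ-^ᵍ n ∣z∣≈1) ⟩
    1# * 1#                   ≈⟨ *-identityˡ 1# ⟩
    1#                        ∎

  ·ᵍ-*ᵍ-combine : ∀ c₁ c₂ w w̄ v r →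
    c₁ *ᵍ r ·ᵍ (w *ᵍ v) +ᵍ c₂ *ᵍ r ·ᵍ (w̄ *ᵍ v) ≈ᵍ (c₁ *ᵍ w +ᵍ c₂ *ᵍ w̄) *ᵍ r ·ᵍ v
  ·ᵍ-*ᵍ-combine (a₁ , b₁) (a₂ , b₂) (p , q) (p̄ , q̄) (s , t) r =
    solve 11 (λ a₁ b₁ a₂ b₂ p q p̄ q̄ s t r →
      a₁ :* (r :* (p :* s :- q :* t)) :- b₁ :* (r :* (q :* s :+ p :* t))
        :+ (a₂ :* (r :* (p̄ :* s :- q̄ :* t)) :- b₂ :* (r :* (q̄ :* s :+ p̄ :* t)))
      := (a₁ :* p :- b₁ :* q :+ (a₂ :* p̄ :- b₂ :* q̄)) :* (r :* s) :- (b₁ :* p :+ a₁ :* q :+ (b₂ :* p̄ :+ a₂ :* q̄)) :* (r :* t))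
      refl a₁ b₁ a₂ b₂ p q p̄ q̄ s t r ,
    solve 11 (λ a₁ b₁ a₂ b₂ p q p̄ q̄ s t r →
      b₁ :* (r :* (p :* s :- q :* t)) :+ a₁ :* (r :* (q :* s :+ p :* t))
        :+ (b₂ :* (r :* (p̄ :* s :- q̄ :* t)) :+ a₂ :* (r :* (q̄ :* s :+ p̄ :* t)))
      := (b₁ :* p :+ a₁ :* q :+ (b₂ :* p̄ :+ a₂ :* q̄)) :* (r :* s) :+ (a₁ :* p :- b₁ :* q :+ (a₂ :* p̄ :- b₂ :* q̄)) :* (r :* t))
      refl a₁ b₁ a₂ b₂ p q p̄ q̄ s t r

  ·ᵍ-congˡ : ∀ {r r′} v → r ≈ r′ → r ·ᵍ v ≈ᵍ r′ ·ᵍ v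
  ·ᵍ-congˡ v r≈r′ = *-congʳ r≈r′ , *-congʳ r≈r′

  ·ᵍ-congʳ : ∀ r {v v′} → v ≈ᵍ v′ → r ·ᵍ v ≈ᵍ r ·ᵍ v′
  ·ᵍ-congʳ r (p , q) = *-congˡ p , *-congˡ q

  real-*ᵍ-·ᵍ : ∀ m r v → (m , 0#) *ᵍ r ·ᵍ v ≈ᵍ (m * r) ·ᵍ v
  real-*ᵍ-·ᵍ m r (p , q) =
    solve 4 (λ m r p q → m :* (r :* p) :- con (+ 0) :* (r :* q) := m :* r :* p) refl m r p q ,
    solve 4 (λ m r p q → con (+ 0) :* (r :* p) :+ m :* (r :* q) := m :* r :* q) refl m r p q

  conj-·ᵍ-*ᵍ1ᵍ : ∀ r w → conj (r ·ᵍ (w *ᵍ 1ᵍ)) ≈ᵍ r ·ᵍ (conj w *ᵍ 1ᵍ)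
  conj-·ᵍ-*ᵍ1ᵍ r (p , q) =
    solve 3 (λ r p q → r :* (p :* con (+ 1) :- q :* con (+ 0)) := r :* (p :* con (+ 1) :- (:- q) :* con (+ 0))) refl r p q ,
    solve 3 (λ r p q → :- (r :* (q :* con (+ 1) :+ p :* con (+ 0))) := r :* ((:- q) :* con (+ 1) :+ p :* con (+ 0))) refl r p q

module ℤ[i] = Gaussian ℤ.+-*-commutativeRing

module GaussianIntegerEmbedding {c ℓ : Level} (R : CommutativeRing c ℓ) where
  open CommutativeRing R
  open IntegerEmbedding R
  open Gaussian R

  fromℤ[i] : ℤ[i].𝔾 → 𝔾
  fromℤ[i] (a , b) = fromℤ a , fromℤ b

  fromℤ[i]-*ᵍ : ∀ z w → fromℤ[i] (z ℤ[i].*ᵍ w) ≈ᵍ fromℤ[i] z *ᵍ fromℤ[i] w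
  fromℤ[i]-*ᵍ (a , b) (c , d) =
    trans (fromℤ-+ (a ℤ.* c) (ℤ.- (b ℤ.* d)))
          (+-cong (fromℤ-* a c) (trans (fromℤ-neg (b ℤ.* d)) (-‿cong (fromℤ-* b d)))) ,
    trans (fromℤ-+ (b ℤ.* c) (a ℤ.* d)) (+-cong (fromℤ-* b c) (fromℤ-* a d))

  fromℤ[i]-^ᵍ : ∀ z n → fromℤ[i] (z ℤ[i].^ᵍ n) ≈ᵍ fromℤ[i] z ^ᵍ n
  fromℤ[i]-^ᵍ z zero    = refl , refl
  fromℤ[i]-^ᵍ z (suc n) =
    ≈ᵍ-trans (fromℤ[i]-*ᵍ z (z ℤ[i].^ᵍ n)) (*ᵍ-cong ≈ᵍ-refl (fromℤ[i]-^ᵍ z n))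

[3+4i]^[1+n]≡3+4i[mod5] : ∀ n → ∃₂ λ k l →
  (+ 3 , + 4) ℤ[i].^ᵍ suc n ≡ (+ 5 ℤ.* k ℤ.+ + 3 , + 5 ℤ.* l ℤ.+ + 4)
[3+4i]^[1+n]≡3+4i[mod5] zero = + 0 , + 0 , ≡.refl
[3+4i]^[1+n]≡3+4i[mod5] (suc n) with [3+4i]^[1+n]≡3+4i[mod5] n
... | k , l , eq =
  + 3 ℤ.* k ℤ.- + 4 ℤ.* l ℤ.- + 2 , + 4 ℤ.* k ℤ.+ + 3 ℤ.* l ℤ.+ + 4 ,
  ≡.trans (≡.cong ((+ 3 , + 4) ℤ[i].*ᵍ_) eq) (≡.cong₂ _,_ (re-step k l) (im-step k l))
  where
  re-step : ∀ k l → + 3 ℤ.* (+ 5 ℤ.* k ℤ.+ + 3) ℤ.- + 4 ℤ.* (+ 5 ℤ.* l ℤ.+ + 4)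
                    ≡ + 5 ℤ.* (+ 3 ℤ.* k ℤ.- + 4 ℤ.* l ℤ.- + 2) ℤ.+ + 3
  re-step = ℤ-Solver.solve-∀
  im-step : ∀ k l → + 4 ℤ.* (+ 5 ℤ.* k ℤ.+ + 3) ℤ.+ + 3 ℤ.* (+ 5 ℤ.* l ℤ.+ + 4)
                    ≡ + 5 ℤ.* (+ 4 ℤ.* k ℤ.+ + 3 ℤ.* l ℤ.+ + 4) ℤ.+ + 4
  im-step = ℤ-Solver.solve-∀

5k+3≢5m : ∀ k m → + 5 ℤ.* k ℤ.+ + 3 ≢ + 5 ℤ.* m
5k+3≢5m k m eq = 5∤3 (∣⇒∣ᵤ (divides (m ℤ.- k) 3≡[m-k]*5))
  where
  3≡[m-k]*5 : + 3 ≡ (m ℤ.- k) ℤ.* + 5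
  3≡[m-k]*5 = begin
    + 3                                   ≡⟨ ℤ-Solver.solve (k ∷ []) ⟩
    (+ 5 ℤ.* k ℤ.+ + 3) ℤ.- + 5 ℤ.* k      ≡⟨ ≡.cong (ℤ._- + 5 ℤ.* k) eq ⟩
    + 5 ℤ.* m ℤ.- + 5 ℤ.* k                ≡⟨ ℤ-Solver.solve (k ∷ m ∷ []) ⟩
    (m ℤ.- k) ℤ.* + 5                      ∎
    where open ≡.≡-Reasoning
  5∤3 : ¬ (5 ℕ∣.∣ 3)
  5∤3 5∣3 with ℕ∣.∣⇒≤ 5∣3
  ... | ℕ.s≤s (ℕ.s≤s (ℕ.s≤s ()))

[5+0i]^n≡5^n : ∀ n → (+ 5 , + 0) ℤ[i].^ᵍ n ≡ ((+ 5) ℤ.^ n , + 0)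
[5+0i]^n≡5^n zero    = ≡.refl
[5+0i]^n≡5^n (suc n) =
  ≡.trans (≡.cong ((+ 5 , + 0) ℤ[i].*ᵍ_) ([5+0i]^n≡5^n n)) (≡.cong (_, + 0) (ℤ.+-identityʳ _))

module _ {c ℓ : Level} (F : Field c ℓ) where
  open Field F hiding (zero)
  open IntegerEmbedding cring
  open Gaussian cring
  open import Algebra.Properties.Ring ring using (x∙y⁻¹≈ε⇒x≈y; -‿distribˡ-*; -1*x≈-x)
  open import Algebra.Properties.CommutativeSemigroup *-commutativeSemigroup using (x∙yz≈y∙xz)
  open import Algebra.Properties.Semiring.Mult.TCOptimised semiring using (1+×)
  open import Relation.Binary.Reasoning.Setoid setoid

  infixr 8 _^_
  _^_ : Carrier → ℕ → Carrier
  _^_ = _^ₑ_ F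

  eval-++ : ∀ p q x y → eval F (p ++ q) x y ≈ eval F p x y + eval F q x y
  eval-++ []                q x y = sym (+-identityˡ _)
  eval-++ ((a , i , j) ∷ p) q x y =
    trans (+-congˡ (eval-++ p q x y)) (sym (+-assoc _ _ _))

  eval-scaleP : ∀ a p x y → eval F (scaleP F a p) x y ≈ a * eval F p x y
  eval-scaleP a []                x y = sym (zeroʳ a)
  eval-scaleP a ((b , i , j) ∷ p) x y = begin
    a * b * m + eval F (scaleP F a p) x y ≈⟨ +-congˡ (eval-scaleP a p x y) ⟩
    a * b * m + a * eval F p x y          ≈⟨ solve 4 (λ a b m e → a :* b :* m :+ a :* e := a :* (b :* m :+ e)) refl a b m (eval F p x y) ⟩
    a * (b * m + eval F p x y)            ∎
    where
    m : Carrier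
    m = x ^ i * y ^ j

  ^-+ : ∀ x i k → x ^ (i ℕ.+ k) ≈ x ^ i * x ^ k
  ^-+ x zero    k = sym (*-identityˡ _)
  ^-+ x (suc i) k = trans (*-congˡ (^-+ x i k)) (sym (*-assoc _ _ _))

  -- The map is the inner function of mulP; Agda identifies the two lambdas by eta for triples.
  eval-monomial-* : ∀ a i j q x y →
    eval F (map (λ { (b , k , l) → (a * b , i ℕ.+ k , j ℕ.+ l) }) q) x y ≈ a * (x ^ i * y ^ j) * eval F q x y
  eval-monomial-* a i j [] x y = sym (zeroʳ _)
  eval-monomial-* a i j ((b , k , l) ∷ q) x y = begin
    a * b * (x ^ (i ℕ.+ k) * y ^ (j ℕ.+ l)) + eval F (map _ q) x y
      ≈⟨ +-cong (*-congˡ (*-cong (^-+ x i k) (^-+ y j l))) (eval-monomial-* a i j q x y) ⟩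
    a * b * ((x ^ i * x ^ k) * (y ^ j * y ^ l)) + a * (x ^ i * y ^ j) * eval F q x y
      ≈⟨ solve 7 (λ a b xi xk yj yl e → a :* b :* ((xi :* xk) :* (yj :* yl)) :+ a :* (xi :* yj) :* e
                   := a :* (xi :* yj) :* (b :* (xk :* yl) :+ e)) refl a b (x ^ i) (x ^ k) (y ^ j) (y ^ l) (eval F q x y) ⟩
    a * (x ^ i * y ^ j) * (b * (x ^ k * y ^ l) + eval F q x y) ∎

  eval-mulP : ∀ p q x y → eval F (mulP F p q) x y ≈ eval F p x y * eval F q x y
  eval-mulP [] q x y = sym (zeroˡ _)
  eval-mulP ((a , i , j) ∷ p) q x y = begin
    eval F (mulP F ((a , i , j) ∷ p) q) x y ≈⟨ eval-++ (map (λ { (b , k , l) → (a * b , i ℕ.+ k , j ℕ.+ l) }) q) (mulP F p q) x y ⟩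
    _ + eval F (mulP F p q) x y ≈⟨ +-cong (eval-monomial-* a i j q x y) (eval-mulP p q x y) ⟩
    a * (x ^ i * y ^ j) * eval F q x y + eval F p x y * eval F q x y ≈⟨ sym (distribʳ _ _ _) ⟩
    (a * (x ^ i * y ^ j) + eval F p x y) * eval F q x y ∎

  ^-cong : ∀ {x x′} n → x ≈ x′ → x ^ n ≈ x′ ^ n
  ^-cong zero    _    = refl
  ^-cong (suc n) x≈x′ = *-cong x≈x′ (^-cong n x≈x′)

  eval-cong : ∀ p {x x′ y y′} → x ≈ x′ → y ≈ y′ → eval F p x y ≈ eval F p x′ y′
  eval-cong []                _    _    = refl
  eval-cong ((a , i , j) ∷ p) x≈x′ y≈y′ =
    +-cong (*-congˡ (*-cong (^-cong i x≈x′) (^-cong j y≈y′))) (eval-cong p x≈x′ y≈y′)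

  eval-oneP : ∀ x y → eval F (oneP F) x y ≈ 1#
  eval-oneP x y = solve 0 (con (+ 1) :* (con (+ 1) :* con (+ 1)) :+ con (+ 0) := con (+ 1)) refl

  eval-powP : ∀ p n x y → eval F (powP F p n) x y ≈ eval F p x y ^ n
  eval-powP p zero    x y = eval-oneP x y
  eval-powP p (suc n) x y = trans (eval-mulP p (powP F p n) x y) (*-congˡ (eval-powP p n x y))

  eval-linP : ∀ a b x y → eval F (linP F a b) x y ≈ a * x + b * y
  eval-linP a b x y = solve 4 (λ a b x y →
    a :* ((x :* con (+ 1)) :* con (+ 1)) :+ (b :* (con (+ 1) :* (y :* con (+ 1))) :+ con (+ 0))
    := a :* x :+ b :* y) refl a b x y

  eval-act : ∀ h p x y → eval F (act F h p) x y ≈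
    eval F p (h fzero fzero * x + h (fsuc fzero) fzero * y) (h fzero (fsuc fzero) * x + h (fsuc fzero) (fsuc fzero) * y)
  eval-act h []                x y = refl
  eval-act h ((a , i , j) ∷ p) x y = begin
    eval F (scaleP F a (mulP F (powP F L₁ i) (powP F L₂ j)) ++ act F h p) x y
      ≈⟨ eval-++ (scaleP F a (mulP F (powP F L₁ i) (powP F L₂ j))) (act F h p) x y ⟩
    eval F (scaleP F a (mulP F (powP F L₁ i) (powP F L₂ j))) x y + eval F (act F h p) x y
      ≈⟨ +-cong (eval-scaleP a (mulP F (powP F L₁ i) (powP F L₂ j)) x y) (eval-act h p x y) ⟩
    a * eval F (mulP F (powP F L₁ i) (powP F L₂ j)) x y + _
      ≈⟨ +-congʳ (*-congˡ (trans (eval-mulP (powP F L₁ i) (powP F L₂ j) x y)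
                                 (*-cong (trans (eval-powP L₁ i x y) (^-cong i (eval-linP _ _ x y)))
                                         (trans (eval-powP L₂ j x y) (^-cong j (eval-linP _ _ x y)))))) ⟩
    _ ∎
    where
    L₁ L₂ : Poly F
    L₁ = linP F (h fzero fzero) (h (fsuc fzero) fzero)
    L₂ = linP F (h fzero (fsuc fzero)) (h (fsuc fzero) (fsuc fzero))
  x≉0∧x*y≈0⇒y≈0 : ∀ {x y} → ¬ x ≈ 0# → x * y ≈ 0# → y ≈ 0#
  x≉0∧x*y≈0⇒y≈0 {x} {y} x≉0 xy≈0 with inverse x x≉0
  ... | x⁻¹ , xx⁻¹≈1 = begin
    y               ≈⟨ solve 3 (λ x x⁻¹ y → y := x⁻¹ :* (x :* y) :+ (con (+ 1) :- x :* x⁻¹) :* y) refl x x⁻¹ y ⟩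
    x⁻¹ * (x * y) + (1# - x * x⁻¹) * y ≈⟨ +-cong (*-congˡ xy≈0) (*-congʳ (+-congˡ (-‿cong xx⁻¹≈1))) ⟩
    x⁻¹ * 0# + (1# - 1#) * y          ≈⟨ solve 2 (λ x⁻¹ y → x⁻¹ :* con (+ 0) :+ (con (+ 1) :- con (+ 1)) :* y := con (+ 0)) refl x⁻¹ y ⟩
    0#              ∎

  -- Multiplying w − z w by the conjugate of 1 − z gives ∣1 − z∣² w = 2 (1 − re z) w.
  fixed-by-rotation⇒≈0 : ¬ (1# + 1#) ≈ 0# → ∀ {z w} → normᵍ z ≈ 1# → ¬ re z ≈ 1# →
                         w ≈ᵍ z *ᵍ w → w ≈ᵍ 0ᵍ
  fixed-by-rotation⇒≈0 2≉0 {c , s} {u , v} ∣z∣≈1 c≉1 (u≈ , v≈) = cancel u-residual , cancel v-residual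
    where
    cancel : ∀ {y} → (1# + 1#) * ((1# - c) * y) ≈ 0# → y ≈ 0#
    cancel = x≉0∧x*y≈0⇒y≈0 (λ 1-c≈0 → c≉1 (sym (x∙y⁻¹≈ε⇒x≈y 1# c 1-c≈0))) ∘ x≉0∧x*y≈0⇒y≈0 2≉0
    substitute : ∀ a b {y} → a * (u - (c * u - s * v)) + b * (v - (s * u + c * v)) + (1# - normᵍ (c , s)) * y
                             ≈ a * (u - u) + b * (v - v) + (1# - 1#) * y
    substitute a b = +-cong (+-cong (*-congˡ (+-congˡ (-‿cong (sym u≈)))) (*-congˡ (+-congˡ (-‿cong (sym v≈)))))
                            (*-congʳ (+-congˡ (-‿cong ∣z∣≈1)))
    u-residual : (1# + 1#) * ((1# - c) * u) ≈ 0#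
    u-residual = begin
      (1# + 1#) * ((1# - c) * u)
        ≈⟨ solve 4 (λ c s u v → con (+ 2) :* ((con (+ 1) :- c) :* u)
             := (con (+ 1) :- c) :* (u :- (c :* u :- s :* v)) :+ (:- s) :* (v :- (s :* u :+ c :* v))
                :+ (con (+ 1) :- (c :* c :+ s :* s)) :* u) refl c s u v ⟩
      (1# - c) * (u - (c * u - s * v)) + (- s) * (v - (s * u + c * v)) + (1# - normᵍ (c , s)) * u
        ≈⟨ substitute (1# - c) (- s) ⟩
      (1# - c) * (u - u) + (- s) * (v - v) + (1# - 1#) * u
        ≈⟨ solve 4 (λ c s u v → (con (+ 1) :- c) :* (u :- u) :+ (:- s) :* (v :- v) :+ (con (+ 1) :- con (+ 1)) :* u
             := con (+ 0)) refl c s u v ⟩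
      0# ∎
    v-residual : (1# + 1#) * ((1# - c) * v) ≈ 0#
    v-residual = begin
      (1# + 1#) * ((1# - c) * v)
        ≈⟨ solve 4 (λ c s u v → con (+ 2) :* ((con (+ 1) :- c) :* v)
             := s :* (u :- (c :* u :- s :* v)) :+ (con (+ 1) :- c) :* (v :- (s :* u :+ c :* v))
                :+ (con (+ 1) :- (c :* c :+ s :* s)) :* v) refl c s u v ⟩
      s * (u - (c * u - s * v)) + (1# - c) * (v - (s * u + c * v)) + (1# - normᵍ (c , s)) * v
        ≈⟨ substitute s (1# - c) ⟩
      s * (u - u) + (1# - c) * (v - v) + (1# - 1#) * v
        ≈⟨ solve 4 (λ c s u v → s :* (u :- u) :+ (con (+ 1) :- c) :* (v :- v) :+ (con (+ 1) :- con (+ 1)) :* v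
             := con (+ 0)) refl c s u v ⟩
      0# ∎
  conj-*ᵍ-cancel : ∀ {x y} v → OnS1 F x y → conj (x , y) *ᵍ ((x , y) *ᵍ v) ≈ᵍ v
  conj-*ᵍ-cancel {x} {y} (p , q) onS1 =
    trans (solve 4 (λ x y p q → x :* (x :* p :- y :* q) :- (:- y) :* (y :* p :+ x :* q) := (x :* x :+ y :* y) :* p) refl x y p q)
          (trans (*-congʳ onS1) (*-identityˡ p)) ,
    trans (solve 4 (λ x y p q → (:- y) :* (x :* p :- y :* q) :+ x :* (y :* p :+ x :* q) := (x :* x :+ y :* y) :* q) refl x y p q)
          (trans (*-congʳ onS1) (*-identityˡ q))
  rotation : 𝔾 → Mat2 F
  rotation (a , b) fzero    fzero    = a
  rotation (a , b) fzero    (fsuc _) = b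
  rotation (a , b) (fsuc _) fzero    = - b
  rotation (a , b) (fsuc _) (fsuc _) = a

  rotation∈SO2 : ∀ {z} → normᵍ z ≈ 1# → InSO2 F (rotation z)
  rotation∈SO2 {a , b} ∣z∣≈1 = rrᵀ≈1 , rᵀr≈1 , via-norm (solve 2 (λ a b → a :* a :- b :* (:- b) := a :* a :+ b :* b) refl a b)
    where
    via-norm : ∀ {e} → e ≈ a * a + b * b → e ≈ 1#
    via-norm e≈ = trans e≈ ∣z∣≈1
    rrᵀ≈1 : _≈ₘ_ F (_·ₘ_ F (rotation (a , b)) (transpose F (rotation (a , b)))) (idM F)
    rrᵀ≈1 fzero    fzero    = ∣z∣≈1
    rrᵀ≈1 fzero    (fsuc _) = solve 2 (λ a b → a :* (:- b) :+ b :* a := con (+ 0)) refl a b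
    rrᵀ≈1 (fsuc _) fzero    = solve 2 (λ a b → (:- b) :* a :+ a :* b := con (+ 0)) refl a b
    rrᵀ≈1 (fsuc _) (fsuc _) = via-norm (solve 2 (λ a b → (:- b) :* (:- b) :+ a :* a := a :* a :+ b :* b) refl a b)
    rᵀr≈1 : _≈ₘ_ F (_·ₘ_ F (transpose F (rotation (a , b))) (rotation (a , b))) (idM F)
    rᵀr≈1 fzero    fzero    = via-norm (solve 2 (λ a b → a :* a :+ (:- b) :* (:- b) := a :* a :+ b :* b) refl a b)
    rᵀr≈1 fzero    (fsuc _) = solve 2 (λ a b → a :* b :+ (:- b) :* a := con (+ 0)) refl a b
    rᵀr≈1 (fsuc _) fzero    = solve 2 (λ a b → b :* a :+ a :* (:- b) := con (+ 0)) refl a b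
    rᵀr≈1 (fsuc _) (fsuc _) = via-norm (solve 2 (λ a b → b :* b :+ a :* a := a :* a :+ b :* b) refl a b)

  eval-act-rotation : ∀ z p x y → eval F (act F (rotation z) p) x y ≈ eval F p (re (z *ᵍ (x , y))) (im (z *ᵍ (x , y)))
  eval-act-rotation (a , b) p x y =
    trans (eval-act (rotation (a , b)) p x y) (eval-cong p (+-congˡ (sym (-‿distribˡ-* b y))) refl)
  Polyᵍ : Set c
  Polyᵍ = Poly F × Poly F

  evalᵍ : Polyᵍ → Carrier → Carrier → 𝔾
  evalᵍ (U , V) x y = eval F U x y , eval F V x y

  actᵍ : Mat2 F → Polyᵍ → Polyᵍ
  actᵍ h (U , V) = act F h U , act F h V

  infixl 7 _⊛_ _·ᴾ_

  _⊛_ : Polyᵍ → Polyᵍ → Polyᵍ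
  (U , V) ⊛ (U′ , V′) = mulP F U U′ ++ scaleP F (- 1#) (mulP F V V′) , mulP F V U′ ++ mulP F U V′

  _·ᴾ_ : 𝔾 → Polyᵍ → Polyᵍ
  (a , b) ·ᴾ (U , V) = scaleP F a U ++ scaleP F (- b) V , scaleP F b U ++ scaleP F a V

  α₁+iα₂ : Polyᵍ
  α₁+iα₂ = linP F 1# 0# , linP F 0# 1#

  [α₁+iα₂]^ : ℕ → Polyᵍ
  [α₁+iα₂]^ zero    = oneP F , []
  [α₁+iα₂]^ (suc n) = α₁+iα₂ ⊛ [α₁+iα₂]^ n

  a*u+[-b]*v≈a*u-b*v : ∀ a b u v → a * u + (- b) * v ≈ a * u - b * v
  a*u+[-b]*v≈a*u-b*v a b u v = +-congˡ (sym (-‿distribˡ-* b v))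

  evalᵍ-⊛ : ∀ P Q x y → evalᵍ (P ⊛ Q) x y ≈ᵍ evalᵍ P x y *ᵍ evalᵍ Q x y
  evalᵍ-⊛ (U , V) (U′ , V′) x y =
    (begin
      eval F (mulP F U U′ ++ scaleP F (- 1#) (mulP F V V′)) x y
        ≈⟨ eval-++ (mulP F U U′) (scaleP F (- 1#) (mulP F V V′)) x y ⟩
      eval F (mulP F U U′) x y + eval F (scaleP F (- 1#) (mulP F V V′)) x y
        ≈⟨ +-cong (eval-mulP U U′ x y) (trans (eval-scaleP (- 1#) (mulP F V V′) x y) (-1*x≈-x _)) ⟩
      eval F U x y * eval F U′ x y + - eval F (mulP F V V′) x y
        ≈⟨ +-congˡ (-‿cong (eval-mulP V V′ x y)) ⟩
      eval F U x y * eval F U′ x y - eval F V x y * eval F V′ x y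
    ∎) ,
    trans (eval-++ (mulP F V U′) (mulP F U V′) x y) (+-cong (eval-mulP V U′ x y) (eval-mulP U V′ x y))

  evalᵍ-·ᴾ : ∀ z P x y → evalᵍ (z ·ᴾ P) x y ≈ᵍ z *ᵍ evalᵍ P x y
  evalᵍ-·ᴾ (a , b) (U , V) x y =
    trans (eval-++ (scaleP F a U) (scaleP F (- b) V) x y)
          (trans (+-cong (eval-scaleP a U x y) (eval-scaleP (- b) V x y)) (a*u+[-b]*v≈a*u-b*v a b _ _)) ,
    trans (eval-++ (scaleP F b U) (scaleP F a V) x y) (+-cong (eval-scaleP b U x y) (eval-scaleP a V x y))

  evalᵍ-α₁+iα₂ : ∀ x y → evalᵍ α₁+iα₂ x y ≈ᵍ (x , y)
  evalᵍ-α₁+iα₂ x y =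
    trans (eval-linP 1# 0# x y) (solve 2 (λ x y → con (+ 1) :* x :+ con (+ 0) :* y := x) refl x y) ,
    trans (eval-linP 0# 1# x y) (solve 2 (λ x y → con (+ 0) :* x :+ con (+ 1) :* y := y) refl x y)

  evalᵍ-[α₁+iα₂]^ : ∀ n x y → evalᵍ ([α₁+iα₂]^ n) x y ≈ᵍ (x , y) ^ᵍ n
  evalᵍ-[α₁+iα₂]^ zero    x y = eval-oneP x y , refl
  evalᵍ-[α₁+iα₂]^ (suc n) x y =
    ≈ᵍ-trans (evalᵍ-⊛ α₁+iα₂ ([α₁+iα₂]^ n) x y) (*ᵍ-cong (evalᵍ-α₁+iα₂ x y) (evalᵍ-[α₁+iα₂]^ n x y))

  evalᵍ-act-[α₁+iα₂]^ : ∀ z n x y →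
    evalᵍ (actᵍ (rotation z) ([α₁+iα₂]^ n)) x y ≈ᵍ evalᵍ (z ^ᵍ n ·ᴾ [α₁+iα₂]^ n) x y
  evalᵍ-act-[α₁+iα₂]^ z n x y =
    ≈ᵍ-trans (eval-act-rotation z (proj₁ ([α₁+iα₂]^ n)) x y , eval-act-rotation z (proj₂ ([α₁+iα₂]^ n)) x y)
   (≈ᵍ-trans (evalᵍ-[α₁+iα₂]^ n _ _)
   (≈ᵍ-trans (^ᵍ-distrib-*ᵍ z (x , y) n)
   (≈ᵍ-trans (*ᵍ-cong ≈ᵍ-refl (≈ᵍ-sym (evalᵍ-[α₁+iα₂]^ n x y)))
             (≈ᵍ-sym (evalᵍ-·ᴾ (z ^ᵍ n) ([α₁+iα₂]^ n) x y)))))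
  Local : (Poly F → Carrier) → Set (c ⊔ ℓ)
  Local ψ = ∀ π → (∀ x y → OnS1 F x y → eval F π x y ≈ 0#) → ψ π ≈ 0#

  linear-local⇒determined-on-S¹ : ∀ {ψ} → IsLinearFunctional F ψ → Local ψ →
    ∀ p q → (∀ x y → OnS1 F x y → eval F p x y ≈ eval F q x y) → ψ p ≈ ψ q
  linear-local⇒determined-on-S¹ {ψ} ψ-linear ψ-local p q p≈q = x∙y⁻¹≈ε⇒x≈y (ψ p) (ψ q) (begin
    ψ p - ψ q                         ≈⟨ +-congˡ (-1*x≈-x (ψ q)) ⟨
    ψ p + - 1# * ψ q                  ≈⟨ +-congˡ (homogeneous (- 1#) q) ⟨
    ψ p + ψ (scaleP F (- 1#) q)       ≈⟨ additive p (scaleP F (- 1#) q) ⟨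
    ψ (p ++ scaleP F (- 1#) q)        ≈⟨ ψ-local _ p-q≈0 ⟩
    0#                                ∎)
    where
    open IsLinearFunctional ψ-linear
    p-q≈0 : ∀ x y → OnS1 F x y → eval F (p ++ scaleP F (- 1#) q) x y ≈ 0#
    p-q≈0 x y onS1 = begin
      eval F (p ++ scaleP F (- 1#) q) x y                   ≈⟨ eval-++ p (scaleP F (- 1#) q) x y ⟩
      eval F p x y + eval F (scaleP F (- 1#) q) x y          ≈⟨ +-cong (p≈q x y onS1) (trans (eval-scaleP (- 1#) q x y) (-1*x≈-x _)) ⟩
      eval F q x y - eval F q x y                            ≈⟨ -‿inverseʳ _ ⟩
      0#                                                     ∎

  module _ {φ φ′ : Poly F → Carrier} where

    difference-linear : IsLinearFunctional F φ → IsLinearFunctional F φ′ → IsLinearFunctional F (λ p → φ p - φ′ p)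
    difference-linear φ-linear φ′-linear = record
      { wellDefined = λ p q p≈q → +-cong (L.wellDefined p q p≈q) (-‿cong (L′.wellDefined p q p≈q))
      ; additive    = λ p q → trans (+-cong (L.additive p q) (-‿cong (L′.additive p q)))
          (solve 4 (λ a b c d → (a :+ b) :- (c :+ d) := (a :- c) :+ (b :- d)) refl (φ p) (φ q) (φ′ p) (φ′ q))
      ; homogeneous = λ a p → trans (+-cong (L.homogeneous a p) (-‿cong (L′.homogeneous a p)))
          (solve 3 (λ a b c → a :* b :- a :* c := a :* (b :- c)) refl a (φ p) (φ′ p))
      }
      where
      module L  = IsLinearFunctional φ-linear
      module L′ = IsLinearFunctional φ′-linear

    difference-local : Local φ → Local φ′ → Local (λ p → φ p - φ′ p)
    difference-local φ-local φ′-local π π≈0 =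
      trans (+-cong (φ-local π π≈0) (-‿cong (φ′-local π π≈0))) (-‿inverseʳ 0#)

  module RotationInvariantFunctional
    (2≉0 : ¬ (1# + 1#) ≈ 0#)
    {z : 𝔾} (∣z∣≈1 : normᵍ z ≈ 1#) (z-aperiodic : ∀ n → ¬ re (z ^ᵍ suc n) ≈ 1#)
    {ψ : Poly F → Carrier} (ψ-linear : IsLinearFunctional F ψ) (ψ-local : Local ψ)
    (ψ-invariant : ∀ p → ψ (act F (rotation z) p) ≈ ψ p) (ψ[1]≈0 : ψ (oneP F) ≈ 0#)
    where

    open IsLinearFunctional ψ-linear

    ψ-determined-on-S¹ : ∀ p q → (∀ x y → OnS1 F x y → eval F p x y ≈ eval F q x y) → ψ p ≈ ψ q
    ψ-determined-on-S¹ = linear-local⇒determined-on-S¹ ψ-linear ψ-local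

    ψ[]≈0 : ψ [] ≈ 0#
    ψ[]≈0 = trans (homogeneous 0# []) (zeroˡ _)

    ψᵍ : Polyᵍ → 𝔾
    ψᵍ (U , V) = ψ U , ψ V

    ψᵍ-·ᴾ : ∀ w P → ψᵍ (w ·ᴾ P) ≈ᵍ w *ᵍ ψᵍ P
    ψᵍ-·ᴾ (a , b) (U , V) =
      trans (additive (scaleP F a U) (scaleP F (- b) V))
            (trans (+-cong (homogeneous a U) (homogeneous (- b) V)) (a*u+[-b]*v≈a*u-b*v a b _ _)) ,
      trans (additive (scaleP F b U) (scaleP F a V)) (+-cong (homogeneous b U) (homogeneous a V))

    ψ-[α₁+iα₂]^suc≈0 : ∀ n → ψᵍ ([α₁+iα₂]^ (suc n)) ≈ᵍ 0ᵍ
    ψ-[α₁+iα₂]^suc≈0 n = fixed-by-rotation⇒≈0 2≉0 (normᵍ-^ᵍ (suc n) ∣z∣≈1) (z-aperiodic n) (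
      ≈ᵍ-trans (≈ᵍ-sym (ψ-invariant U , ψ-invariant V))
      (≈ᵍ-trans (ψ-determined-on-S¹ _ _ (λ x y _ → proj₁ (rotated x y)) , ψ-determined-on-S¹ _ _ (λ x y _ → proj₂ (rotated x y)))
                (ψᵍ-·ᴾ (z ^ᵍ suc n) P)))
      where
      P : Polyᵍ
      P = [α₁+iα₂]^ (suc n)
      U V : Poly F
      U = proj₁ P
      V = proj₂ P
      rotated : ∀ x y → evalᵍ (actᵍ (rotation z) P) x y ≈ᵍ evalᵍ (z ^ᵍ suc n ·ᴾ P) x y
      rotated = evalᵍ-act-[α₁+iα₂]^ z (suc n)

    Annihilated : (Carrier → Carrier → Carrier) → Set (c ⊔ ℓ)
    Annihilated f = Σ (Poly F) λ p → (∀ x y → OnS1 F x y → eval F p x y ≈ f x y) × ψ p ≈ 0#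

    annihilated-resp : ∀ {f g} → (∀ x y → OnS1 F x y → f x y ≈ g x y) → Annihilated f → Annihilated g
    annihilated-resp f≈g (p , p≈f , ψp≈0) = p , (λ x y onS1 → trans (p≈f x y onS1) (f≈g x y onS1)) , ψp≈0

    annihilated-+ : ∀ {f g} → Annihilated f → Annihilated g → Annihilated (λ x y → f x y + g x y)
    annihilated-+ (p , p≈f , ψp≈0) (q , q≈g , ψq≈0) =
      p ++ q ,
      (λ x y onS1 → trans (eval-++ p q x y) (+-cong (p≈f x y onS1) (q≈g x y onS1))) ,
      trans (additive p q) (trans (+-cong ψp≈0 ψq≈0) (+-identityʳ 0#))

    annihilated-* : ∀ {f} r → Annihilated f → Annihilated (λ x y → r * f x y)
    annihilated-* r (p , p≈f , ψp≈0) =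
      scaleP F r p ,
      (λ x y onS1 → trans (eval-scaleP r p x y) (*-congˡ (p≈f x y onS1))) ,
      trans (homogeneous r p) (trans (*-congˡ ψp≈0) (zeroʳ r))

    record Annihilatedᵍ (g : Carrier → Carrier → 𝔾) : Set (c ⊔ ℓ) where
      constructor annihilatedᵍ
      field
        re-annihilated : Annihilated (λ x y → re (g x y))
        im-annihilated : Annihilated (λ x y → im (g x y))

    annihilatedᵍ-resp : ∀ {g h} → (∀ x y → OnS1 F x y → g x y ≈ᵍ h x y) → Annihilatedᵍ g → Annihilatedᵍ h
    annihilatedᵍ-resp g≈h (annihilatedᵍ A B) = annihilatedᵍ
      (annihilated-resp (λ x y onS1 → proj₁ (g≈h x y onS1)) A)
      (annihilated-resp (λ x y onS1 → proj₂ (g≈h x y onS1)) B)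

    annihilatedᵍ-+ᵍ : ∀ {g h} → Annihilatedᵍ g → Annihilatedᵍ h → Annihilatedᵍ (λ x y → g x y +ᵍ h x y)
    annihilatedᵍ-+ᵍ (annihilatedᵍ A B) (annihilatedᵍ A′ B′) = annihilatedᵍ (annihilated-+ A A′) (annihilated-+ B B′)

    annihilatedᵍ-*ᵍ : ∀ {g} w → Annihilatedᵍ g → Annihilatedᵍ (λ x y → w *ᵍ g x y)
    annihilatedᵍ-*ᵍ (a , b) (annihilatedᵍ A B) = annihilatedᵍ
      (annihilated-resp (λ x y _ → a*u+[-b]*v≈a*u-b*v a b _ _) (annihilated-+ (annihilated-* a A) (annihilated-* (- b) B)))
      (annihilated-+ (annihilated-* b A) (annihilated-* a B))

    annihilatedᵍ-conj : ∀ {g} → Annihilatedᵍ g → Annihilatedᵍ (λ x y → conj (g x y))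
    annihilatedᵍ-conj (annihilatedᵍ A B) = annihilatedᵍ A (annihilated-resp (λ x y _ → -1*x≈-x _) (annihilated-* (- 1#) B))

    PowersAnnihilated : (Carrier → Carrier → Carrier) → Set (c ⊔ ℓ)
    PowersAnnihilated f = ∀ n → Annihilatedᵍ (λ x y → f x y ·ᵍ (x , y) ^ᵍ n)

    powersAnnihilated-resp : ∀ {f g} → (∀ x y → f x y ≈ g x y) → PowersAnnihilated f → PowersAnnihilated g
    powersAnnihilated-resp f≈g hyp n = annihilatedᵍ-resp (λ x y _ → ·ᵍ-congˡ ((x , y) ^ᵍ n) (f≈g x y)) (hyp n)

    powersAnnihilated-1 : PowersAnnihilated (λ _ _ → 1#)
    powersAnnihilated-1 zero = annihilatedᵍ
      (oneP F , (λ x y _ → trans (eval-oneP x y) (sym (*-identityʳ 1#))) , ψ[1]≈0)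
      ([] , (λ _ _ _ → sym (zeroʳ 1#)) , ψ[]≈0)
    powersAnnihilated-1 (suc n) = annihilatedᵍ
      (U , (λ x y _ → trans (proj₁ (evalᵍ-[α₁+iα₂]^ (suc n) x y)) (sym (*-identityˡ _))) , proj₁ (ψ-[α₁+iα₂]^suc≈0 n))
      (V , (λ x y _ → trans (proj₂ (evalᵍ-[α₁+iα₂]^ (suc n) x y)) (sym (*-identityˡ _))) , proj₂ (ψ-[α₁+iα₂]^suc≈0 n))
      where
      U V : Poly F
      U = proj₁ ([α₁+iα₂]^ (suc n))
      V = proj₂ ([α₁+iα₂]^ (suc n))

    powersAnnihilated-step : ∀ {f m : Carrier → Carrier → Carrier} (c₁ c₂ : 𝔾) →
      (∀ x y → (m x y , 0#) ≈ᵍ c₁ *ᵍ (x , y) +ᵍ c₂ *ᵍ conj (x , y)) →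
      PowersAnnihilated f → PowersAnnihilated (λ x y → m x y * f x y)
    powersAnnihilated-step {f} {m} c₁ c₂ m≈ hyp n =
      annihilatedᵍ-resp combine (annihilatedᵍ-+ᵍ (annihilatedᵍ-*ᵍ c₁ (hyp (suc n))) (annihilatedᵍ-*ᵍ c₂ (lowered n)))
      where
      -- On S¹, w̄ wⁿ⁺¹ = wⁿ; for n = 0 the term w̄ is instead the conjugate of w¹.
      lowered : ∀ n → Annihilatedᵍ (λ x y → f x y ·ᵍ (conj (x , y) *ᵍ (x , y) ^ᵍ n))
      lowered zero    = annihilatedᵍ-resp (λ x y _ → conj-·ᵍ-*ᵍ1ᵍ (f x y) (x , y)) (annihilatedᵍ-conj (hyp 1))
      lowered (suc k) = annihilatedᵍ-resp (λ x y onS1 → ≈ᵍ-sym (·ᵍ-congʳ (f x y) (conj-*ᵍ-cancel ((x , y) ^ᵍ k) onS1))) (hyp k)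
      combine : ∀ x y → OnS1 F x y →
        c₁ *ᵍ f x y ·ᵍ (x , y) ^ᵍ suc n +ᵍ c₂ *ᵍ f x y ·ᵍ (conj (x , y) *ᵍ (x , y) ^ᵍ n) ≈ᵍ (m x y * f x y) ·ᵍ (x , y) ^ᵍ n
      combine x y _ =
        ≈ᵍ-trans (·ᵍ-*ᵍ-combine c₁ c₂ (x , y) (conj (x , y)) ((x , y) ^ᵍ n) (f x y))
        (≈ᵍ-trans (*ᵍ-cong (≈ᵍ-sym (m≈ x y)) ≈ᵍ-refl)
                  (real-*ᵍ-·ᵍ (m x y) (f x y) ((x , y) ^ᵍ n)))

    ½ : Carrier
    ½ = proj₁ (inverse (1# + 1#) 2≉0)

    2*½≈1 : (1# + 1#) * ½ ≈ 1#
    2*½≈1 = proj₂ (inverse (1# + 1#) 2≉0)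

    [x,0]≈[w+w̄]/2 : ∀ x y → (x , 0#) ≈ᵍ (½ , 0#) *ᵍ (x , y) +ᵍ (½ , 0#) *ᵍ conj (x , y)
    [x,0]≈[w+w̄]/2 x y =
      trans (sym (trans (*-congʳ 2*½≈1) (*-identityˡ x)))
            (solve 3 (λ h x y → con (+ 2) :* h :* x
                                := h :* x :- con (+ 0) :* y :+ (h :* x :- con (+ 0) :* (:- y))) refl ½ x y) ,
      solve 3 (λ h x y → con (+ 0) := con (+ 0) :* x :+ h :* y :+ (con (+ 0) :* x :+ h :* (:- y))) refl ½ x y

    [y,0]≈[w-w̄]/2i : ∀ x y → (y , 0#) ≈ᵍ (0# , - ½) *ᵍ (x , y) +ᵍ (0# , ½) *ᵍ conj (x , y)
    [y,0]≈[w-w̄]/2i x y =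
      trans (sym (trans (*-congʳ 2*½≈1) (*-identityˡ y)))
            (solve 3 (λ h x y → con (+ 2) :* h :* y
                                := con (+ 0) :* x :- (:- h) :* y :+ (con (+ 0) :* x :- h :* (:- y))) refl ½ x y) ,
      solve 3 (λ h x y → con (+ 0) := (:- h) :* x :+ con (+ 0) :* y :+ (h :* x :+ con (+ 0) :* (:- y))) refl ½ x y

    powersAnnihilated-monomial : ∀ i j → PowersAnnihilated (λ x y → x ^ i * y ^ j)
    powersAnnihilated-monomial zero    zero    =
      powersAnnihilated-resp (λ _ _ → sym (*-identityˡ 1#)) powersAnnihilated-1
    powersAnnihilated-monomial zero    (suc j) =
      powersAnnihilated-resp (λ x y → x∙yz≈y∙xz y 1# (y ^ j))
        (powersAnnihilated-step _ _ [y,0]≈[w-w̄]/2i (powersAnnihilated-monomial zero j))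
    powersAnnihilated-monomial (suc i) j       =
      powersAnnihilated-resp (λ x y → sym (*-assoc x (x ^ i) (y ^ j)))
        (powersAnnihilated-step _ _ [x,0]≈[w+w̄]/2 (powersAnnihilated-monomial i j))

    annihilated-eval : ∀ π → Annihilated (eval F π)
    annihilated-eval []                = [] , (λ _ _ _ → refl) , ψ[]≈0
    annihilated-eval ((a , i , j) ∷ π) =
      annihilated-+ (annihilated-* a (annihilated-resp (λ x y _ → *-identityʳ _) monomial)) (annihilated-eval π)
      where
      monomial : Annihilated (λ x y → (x ^ i * y ^ j) * 1#)
      monomial = Annihilatedᵍ.re-annihilated (powersAnnihilated-monomial i j 0)

    ψ≈0 : ∀ π → ψ π ≈ 0#
    ψ≈0 π with annihilated-eval π
    ... | p , p≈π , ψp≈0 = trans (ψ-determined-on-S¹ π p (λ x y onS1 → sym (p≈π x y onS1))) ψp≈0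

  module _ (char0 : CharZero F) where
    open GaussianIntegerEmbedding cring

    fromℤ-injective-char0 : ∀ {i j} → fromℤ i ≈ fromℤ j → i ≡ j
    fromℤ-injective-char0 = fromℤ-injective (λ n n≈0 → char0 n (trans (natₑ≈fromℤ n) n≈0))
      where
      natₑ≈fromℤ : ∀ n → natₑ F n ≈ fromℤ (+ n)
      natₑ≈fromℤ zero    = refl
      natₑ≈fromℤ (suc n) = trans (+-congˡ (natₑ≈fromℤ n)) (sym (1+× n 1#))

    2≉0 : ¬ (1# + 1#) ≈ 0#
    2≉0 2≈0 with fromℤ-injective-char0 {+ 2} {+ 0} 2≈0
    ... | ()

    5≉0 : ¬ fromℤ (+ 5) ≈ 0#
    5≉0 5≈0 with fromℤ-injective-char0 {+ 5} {+ 0} 5≈0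
    ... | ()

    ⅕ : Carrier
    ⅕ = proj₁ (inverse (fromℤ (+ 5)) 5≉0)

    5*⅕≈1 : fromℤ (+ 5) * ⅕ ≈ 1#
    5*⅕≈1 = proj₂ (inverse (fromℤ (+ 5)) 5≉0)

    [3+4i]/5 : 𝔾
    [3+4i]/5 = fromℤ (+ 3) * ⅕ , fromℤ (+ 4) * ⅕

    ∣[3+4i]/5∣≈1 : normᵍ [3+4i]/5 ≈ 1#
    ∣[3+4i]/5∣≈1 = begin
      normᵍ [3+4i]/5              ≈⟨ solve 1 (λ h → (con (+ 3) :* h) :* (con (+ 3) :* h) :+ (con (+ 4) :* h) :* (con (+ 4) :* h)
                                               := (con (+ 5) :* h) :* (con (+ 5) :* h)) refl ⅕ ⟩
      (fromℤ (+ 5) * ⅕) * (fromℤ (+ 5) * ⅕) ≈⟨ *-cong 5*⅕≈1 5*⅕≈1 ⟩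
      1# * 1#                     ≈⟨ *-identityˡ 1# ⟩
      1#                          ∎

    5*[3+4i]/5≈3+4i : fromℤ[i] (+ 5 , + 0) *ᵍ [3+4i]/5 ≈ᵍ fromℤ[i] (+ 3 , + 4)
    5*[3+4i]/5≈3+4i =
      trans (solve 1 (λ h → con (+ 5) :* (con (+ 3) :* h) :- con (+ 0) :* (con (+ 4) :* h) := con (+ 3) :* (con (+ 5) :* h)) refl ⅕)
            (trans (*-congˡ 5*⅕≈1) (*-identityʳ _)) ,
      trans (solve 1 (λ h → con (+ 0) :* (con (+ 3) :* h) :+ con (+ 5) :* (con (+ 4) :* h) := con (+ 4) :* (con (+ 5) :* h)) refl ⅕)
            (trans (*-congˡ 5*⅕≈1) (*-identityʳ _))

    -- Re zᵐ = 1 would give Re (3 + 4i)ᵐ = 5ᵐ after clearing denominators, against the residue 3 mod 5.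
    [3+4i]/5-aperiodic : ∀ n → ¬ re ([3+4i]/5 ^ᵍ suc n) ≈ 1#
    [3+4i]/5-aperiodic n re≈1 with [3+4i]^[1+n]≡3+4i[mod5] n
    ... | k , _ , [3+4i]^m≡ = 5k+3≢5m k ((+ 5) ℤ.^ n)
      (≡.trans (≡.sym (≡.cong proj₁ [3+4i]^m≡)) (fromℤ-injective-char0 (begin
        fromℤ (ℤ[i].re ((+ 3 , + 4) ℤ[i].^ᵍ m))       ≈⟨ proj₁ (fromℤ[i]-^ᵍ (+ 3 , + 4) m) ⟩
        re (fromℤ[i] (+ 3 , + 4) ^ᵍ m)                 ≈⟨ proj₁ (^ᵍ-cong m (≈ᵍ-sym 5*[3+4i]/5≈3+4i)) ⟩
        re ((fromℤ[i] (+ 5 , + 0) *ᵍ [3+4i]/5) ^ᵍ m)   ≈⟨ proj₁ (^ᵍ-distrib-*ᵍ (fromℤ[i] (+ 5 , + 0)) [3+4i]/5 m) ⟩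
        re (fromℤ[i] (+ 5 , + 0) ^ᵍ m *ᵍ [3+4i]/5 ^ᵍ m) ≈⟨ proj₁ (*ᵍ-cong (≈ᵍ-sym (fromℤ[i]-^ᵍ (+ 5 , + 0) m)) ≈ᵍ-refl) ⟩
        re (fromℤ[i] ((+ 5 , + 0) ℤ[i].^ᵍ m) *ᵍ [3+4i]/5 ^ᵍ m)
          ≡⟨ ≡.cong (λ w → re (fromℤ[i] w *ᵍ [3+4i]/5 ^ᵍ m)) ([5+0i]^n≡5^n m) ⟩
        fromℤ ((+ 5) ℤ.^ m) * re ([3+4i]/5 ^ᵍ m) - 0# * im ([3+4i]/5 ^ᵍ m)
          ≈⟨ +-cong (*-congˡ re≈1) (-‿cong (zeroˡ _)) ⟩
        fromℤ ((+ 5) ℤ.^ m) * 1# - 0#                  ≈⟨ solve 1 (λ a → a :* con (+ 1) :- con (+ 0) := a) refl (fromℤ ((+ 5) ℤ.^ m)) ⟩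
        fromℤ ((+ 5) ℤ.^ m)                            ∎)))
      where
      m : ℕ
      m = suc n

theorem13 : {c ℓ : Level} (F : Field c ℓ) → CharZero F →
    (φ φ′ : Poly F → Field.Carrier F) →
    IsCircularIntegralFunctional F φ → IsCircularIntegralFunctional F φ′ →
    ∀ π → Field._≈_ F (φ π) (φ′ π)
theorem13 F char0 φ φ′ φ-circular φ′-circular π = x∙y⁻¹≈ε⇒x≈y (φ π) (φ′ π) (ψ≈0 π)
  where
  open Field F
  open import Algebra.Properties.Ring ring using (x∙y⁻¹≈ε⇒x≈y)
  module C  = IsCircularIntegralFunctional φ-circular
  module C′ = IsCircularIntegralFunctional φ′-circular
  R : Mat2 F
  R = rotation F ([3+4i]/5 F char0)
  R∈SO2 : InSO2 F R
  R∈SO2 = rotation∈SO2 F (∣[3+4i]/5∣≈1 F char0)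
  open RotationInvariantFunctional F (2≉0 F char0) (∣[3+4i]/5∣≈1 F char0) ([3+4i]/5-aperiodic F char0)
    (difference-linear F C.linear C′.linear) (difference-local F C.locality C′.locality)
    (λ p → +-cong (C.invariance p R R∈SO2) (-‿cong (C′.invariance p R R∈SO2)))
    (trans (+-cong C.normalization (-‿cong C′.normalization)) (-‿inverseʳ 1#))
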